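{- Let $\mathcal{P}=\langle P^\iota\rangle_{\iota\in I}$ be a concurrent program, $F$ a set of local states of $\mathcal{P}$, and fix a type of objective (reachability or safety). Let $\mathcal{G}=\mathcal{G}(\mathcal{P})$ be the TSO game with the winning condition of that type induced by $F$, and for each $\iota\in I$ let $\mathcal{G}^\iota=\mathcal{G}(\langle P^\iota\rangle)$ be the TSO game of the single-process program $\langle P^\iota\rangle$ with the winning condition of the same type induced by $F\cap Q^\iota$. Let $c_0$ be a TSO configuration of $\mathcal{P}$ in which all buffers are empty and no process is in a state of $F$. Then the process player wins $\mathcal{G}$ from $(c_0)_A$ if and only if there exists $\iota\in I$ such that the process player wins $\mathcal{G}^\iota$ from $\langle s(c_0)(\iota),b(c_0)(\iota),m(c_0)\rangle_A$.
   Context: Let $V$ be a finite data domain and $X$ a finite set of shared variables over $V$. Instructions are $\mathrm{rd}(x,d)$, $\mathrm{wr}(x,d)$ ($x\in X,d\in V$), $\mathrm{skip}$ and $\mathrm{mf}$ (memory fence). A process is a finite labelled transition system $P=\langle Q,\mathrm{Instrs},\delta\rangle$. A concurrent program is a tuple $\mathcal{P}=\langle P^\iota\rangle_{\iota\in I}$, $I$ finite, $P^\iota=\langle Q^\iota,\mathrm{Instrs},\delta^\iota\rangle$. A TSO configuration is $c=\langle s,b,m\rangle$ with $s(\iota)\in Q^\iota$, $b:I\to (X\times V)^*$ (FIFO buffers; new messages added on the left, oldest on the right), $m:X\to V$. TSO transitions: (read-own-write) if $s(\iota)\xrightarrow{\mathrm{rd}(x,d)} q'$ and the most recent message on $x$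 in $b(\iota)$ is $\langle x,d\rangle$, move $s(\iota)$ to $q'$; (read-from-memory) if $s(\iota)\xrightarrow{\mathrm{rd}(x,d)}q'$, $b(\iota)$ has no message on $x$, and $m(x)=d$, move to $q'$; (write) if $s(\iota)\xrightarrow{\mathrm{wr}(x,d)}q'$, move to $q'$ and set $b(\iota):=\langle x,d\rangle\cdot b(\iota)$; (skip) move along a $\mathrm{skip}$ edge; (memory fence) if $s(\iota)\xrightarrow{\mathrm{mf}}q'$ and $b(\iota)=\varepsilon$, move to $q'$; (update) if $b(\iota)=w\cdot\langle x,d\rangle$, set $b(\iota):=w$, $m(x):=d$. $c\xrightarrow{\mathrm{up}^*}c'$ means zero or more updates. A game $\langle C,C_A,C_B,\to\rangle$: a play is an infinite sequence of moves or a finite one ending in a configuration with no successors. A winning condition is a set of infinite plays; player A wins a play if it is infinite and in the winning condition or finite ending in $C_B$; otherwise B wins. A configuration is winning for a player if she has a strategy winning against all opponent strategies. The TSO game $\mathcal{G}(\mathcal{P})$ has $C_A$, $C_B$ copies of all TSO configurations; the process player (A) moves $c_A\to c'_B$ for every instruction transition $c\to c'$ of any process; the update player (B) moves $c_B\to c'_A$ for every $c'$ with $c\xrightarrow{\mathrm{up}^*}c'$. For a set $F$ of local states, $C_F$ is the set of game configurations in which some process is in a state of $F$; the reachability condition is the set of plays visiting $C_F$, the safety condition the set of plays never visiting $C_F$. In reachability games it is assumed that no process can deadlock from a target state. -}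

module Defs where

open import Data.Nat using (ℕ; zero; suc; _<_)
open import Data.Fin using (Fin; toℕ)
open import Data.Bool using (Bool; true; false)
open import Data.List using (List; []; _∷_; _++_; [_]; tabulate)
open import Data.Maybe using (Maybe; just; nothing)
open import Data.Product using (Σ; ∃; _×_; _,_; proj₁; proj₂)
open import Data.Sum using (_⊎_)
open import Relation.Nullary using (¬_; yes; no)
open import Relation.Binary.PropositionalEquality using (_≡_; _≢_)
open import Relation.Binary.Construct.Closure.ReflexiveTransitive using (Star)
open import Data.Fin using (_≟_)

data Player : Set where
  A B : Player

record Game : Set₁ where
  field
    Pos   : Set
    owner : Pos → Player
    _⇒_   : Pos → Pos → Set

module _ (G : Game) where
  open Game G

  -- A strategy of player p: given the history (earlier positions, oldest
  -- first) and the current position, it chooses a successor; it must be a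
  -- legal move whenever the current position belongs to p and has a successor.
  Strategy : Player → Set
  Strategy p = Σ (List Pos → Pos → Pos) λ σ →
    ∀ h c → owner c ≡ p → (∃ λ c' → c ⇒ c') → c ⇒ σ h c

  prefix : (ℕ → Pos) → ℕ → List Pos
  prefix f k = tabulate {n = k} (λ i → f (toℕ i))

  Obeys : (p : Player) → Strategy p → (ℕ → Pos) → ℕ → Set
  Obeys p σ f k = owner (f k) ≡ p → f (suc k) ≡ proj₁ σ (prefix f k) (f k)

  data Play (c : Pos) : Set where
    infinite : (f : ℕ → Pos) → f 0 ≡ c → (∀ k → f k ⇒ f (suc k)) → Play c
    finite   : (n : ℕ) (f : ℕ → Pos) → f 0 ≡ c →
               (∀ k → k < n → f k ⇒ f (suc k)) →
               (∀ c' → ¬ (f n ⇒ c')) → Play c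

  Outcome : Strategy A → Strategy B → (c : Pos) → Play c → Set
  Outcome σ τ c (infinite f _ _) = ∀ k → Obeys A σ f k × Obeys B τ f k
  Outcome σ τ c (finite n f _ _ _) = ∀ k → k < n → Obeys A σ f k × Obeys B τ f k

  WinCond : Set₁
  WinCond = (ℕ → Pos) → Set

  AWinsPlay : WinCond → {c : Pos} → Play c → Set
  AWinsPlay W (infinite f _ _) = W f
  AWinsPlay W (finite n f _ _ _) = owner (f n) ≡ B

  AWinsFrom : WinCond → Pos → Set
  AWinsFrom W c = Σ (Strategy A) λ σ → ∀ (τ : Strategy B) (π : Play c) →
    Outcome σ τ c π → AWinsPlay W π

-- Instructions, processes, programs (X = Fin nX, V = Fin nV)

data Instr (nX nV : ℕ) : Set where
  rd wr : Fin nX → Fin nV → Instr nX nV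
  skip mf : Instr nX nV

record Process (nX nV : ℕ) : Set where
  field
    nQ : ℕ
    δ  : Fin nQ → Instr nX nV → Fin nQ → Bool

open Process public

Program : (nX nV nI : ℕ) → Set
Program nX nV nI = Fin nI → Process nX nV

Buffer : ℕ → ℕ → Set
Buffer nX nV = List (Fin nX × Fin nV)

-- value of the most recent (leftmost) message on x in a buffer
latest : ∀ {nX nV} → Buffer nX nV → Fin nX → Maybe (Fin nV)
latest [] x = nothing
latest ((y , d) ∷ w) x with y ≟ x
... | yes _ = just d
... | no  _ = latest w x

record Config {nX nV nI : ℕ} (P : Program nX nV nI) : Set where
  constructor ⟨_,_,_⟩
  field
    s : (ι : Fin nI) → Fin (nQ (P ι))
    b : Fin nI → Buffer nX nV
    m : Fin nX → Fin nV

open Config public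

module _ {nX nV nI : ℕ} {P : Program nX nV nI} where

  data Effect (c c' : Config P) (ι : Fin nI) : Instr nX nV → Set where
    rd-own : ∀ x d → latest (b c ι) x ≡ just d →
             b c' ι ≡ b c ι → (∀ y → m c' y ≡ m c y) → Effect c c' ι (rd x d)
    rd-mem : ∀ x d → latest (b c ι) x ≡ nothing → m c x ≡ d →
             b c' ι ≡ b c ι → (∀ y → m c' y ≡ m c y) → Effect c c' ι (rd x d)
    write  : ∀ x d → b c' ι ≡ (x , d) ∷ b c ι →
             (∀ y → m c' y ≡ m c y) → Effect c c' ι (wr x d)
    skp    : b c' ι ≡ b c ι → (∀ y → m c' y ≡ m c y) → Effect c c' ι skip
    fence  : b c ι ≡ [] → b c' ι ≡ b c ι →
             (∀ y → m c' y ≡ m c y) → Effect c c' ι mf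

  record InstrStepBy (ι : Fin nI) (c c' : Config P) : Set where
    field
      instr  : Instr nX nV
      local  : δ (P ι) (s c ι) instr (s c' ι) ≡ true
      effect : Effect c c' ι instr
      othersS : ∀ j → j ≢ ι → s c' j ≡ s c j
      othersB : ∀ j → j ≢ ι → b c' j ≡ b c j

  InstrStep : Config P → Config P → Set
  InstrStep c c' = ∃ λ ι → InstrStepBy ι c c'

  -- update: oldest (rightmost) message of some buffer goes to memory
  record UpdateStep (c c' : Config P) : Set where
    field
      ι : Fin nI
      x : Fin nX
      d : Fin nV
      w : Buffer nX nV
      buf    : b c ι ≡ w ++ [ (x , d) ]
      buf'   : b c' ι ≡ w
      memx   : m c' x ≡ d
      memy   : ∀ y → y ≢ x → m c' y ≡ m c y
      sameS  : ∀ j → s c' j ≡ s c j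
      othersB : ∀ j → j ≢ ι → b c' j ≡ b c j

  Updates : Config P → Config P → Set
  Updates = Star UpdateStep

module _ {nX nV nI : ℕ} (P : Program nX nV nI) where

  data Move : Config P × Player → Config P × Player → Set where
    proc : ∀ {c c'} → InstrStep c c' → Move (c , A) (c' , B)
    upd  : ∀ {c c'} → Updates c c' → Move (c , B) (c' , A)

  TSOGame : Game
  TSOGame = record { Pos = Config P × Player ; owner = proj₂ ; _⇒_ = Move }

-- set of local states: F ι q ≡ true iff q ∈ F ∩ Q^ι
LocalStates : ∀ {nX nV nI} → Program nX nV nI → Set
LocalStates {nI = nI} P = (ι : Fin nI) → Fin (nQ (P ι)) → Bool

InF : ∀ {nX nV nI} {P : Program nX nV nI} → LocalStates P → Config P → Set
InF {nI = nI} F c = Σ (Fin nI) λ ι → F ι (s c ι) ≡ true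

data Objective : Set where
  reachability safety : Objective

winCond : ∀ {nX nV nI} (P : Program nX nV nI) → Objective → LocalStates P →
          WinCond (TSOGame P)
winCond P reachability F f = ∃ λ n → InF F (proj₁ (f n))
winCond P safety       F f = ∀ n → ¬ InF F (proj₁ (f n))

LEdge : ∀ {nX nV} (Pr : Process nX nV) → Fin (nQ Pr) → Fin (nQ Pr) → Set
LEdge Pr q q' = ∃ λ i → δ Pr q i q' ≡ true

-- standing assumption for reachability games: no process can deadlock from a
-- target state, i.e. whenever process ι is in a local state reachable from a
-- state of F, it has an enabled instruction transition (whatever the buffers
-- and memory are).
NoDeadlockFromTarget : ∀ {nX nV nI} (P : Program nX nV nI) → LocalStates P → Set
NoDeadlockFromTarget P F = ∀ ι q q' → F ι q ≡ true → Star (LEdge (P ι)) q q' →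
  ∀ (c : Config P) → s c ι ≡ q' → ∃ λ c' → InstrStepBy ι c c'

single : ∀ {nX nV nI} → Program nX nV nI → Fin nI → Program nX nV 1
single P ι = λ _ → P ι

restrict : ∀ {nX nV nI} (P : Program nX nV nI) → LocalStates P → (ι : Fin nI) →
           LocalStates (single P ι)
restrict P F ι = λ _ → F ι

project : ∀ {nX nV nI} {P : Program nX nV nI} → Config P → (ι : Fin nI) →
          Config (single P ι)
project c ι = ⟨ (λ _ → s c ι) , (λ _ → b c ι) , m c ⟩

ProcessWins : ∀ {nX nV nI} (P : Program nX nV nI) → Objective → LocalStates P →
              Config P → Set
ProcessWins P o F c = AWinsFrom (TSOGame P) (winCond P o F) (c , A)

module Submission where

-- The update player may choose never to update.  Then each process only ever
-- sees its own writes on top of the initial memory, so the processes run in isolation, and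
-- what a process observes is a finite "view": its local state, whether its buffer is empty,
-- and the value it would read for each variable.
--   (⇒) Play the winning strategy against the idle update player.  For reachability, the
-- process that hits F can then run on forever (no deadlock from a target); for safety, some
-- process makes two moves from the same view (pigeonhole), which closes a lasso.  Either way
-- one process has an isolated infinite run of views meeting the objective.
--   (⇐) A single-process winning strategy against the idle update player yields such a run.
-- Conversely, given an isolated run of ι, the process player wins by moving ι alone along it:
-- updates flush only ι's buffer, which never changes what ι reads, and every other process
-- stays in its initial state (not in F) with an empty buffer.

open import Defs
open import Data.Bool using (Bool; true; false)
open import Data.Bool.Properties using () renaming (_≟_ to _≟ᵇ_)
open import Data.Empty using (⊥-elim)
open import Data.Fin using (Fin; zero; toℕ; _≟_)
open import Data.Fin.Properties using (any?; pigeonhole)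
open import Data.List as List
  using (List; []; _∷_; _++_; [_]; length; null; allFin; concatMap; cartesianProduct; cartesianProductWith)
open import Data.List.Membership.Propositional using (_∈_; lose)
open import Data.List.Membership.Propositional.Properties
  using (∈-allFin; ∈-map⁺; ∈-concatMap⁺; ∈-cartesianProduct⁺; ∈-cartesianProductWith⁺)
open import Data.List.Properties using (++-conicalʳ; length-tabulate)
open import Data.List.Relation.Unary.Any using (here; there; index)
open import Data.List.Relation.Unary.Any.Properties using (lookup-index)
open import Data.Maybe using (just; nothing; fromMaybe)
open import Data.Nat using (ℕ; zero; suc; _*_; _<_; _≤′_; ≤′-refl; ≤′-step; ⌊_/2⌋)
open import Data.Nat.Properties using (≤-refl; n<1+n; m<n⇒m<1+n; m<1+n⇒m<n∨m≡n; z≤′n; ≤⇒≤′)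
open import Data.Product using (Σ; ∃; ∃₂; _×_; _,_; proj₁; proj₂)
open import Data.Sum using (_⊎_; inj₁; inj₂)
open import Data.Unit using (⊤; tt)
open import Data.Vec using (Vec; lookup; tabulate; _[_]≔_) renaming ([] to []ᵛ; _∷_ to _∷ᵛ_)
open import Data.Vec.Properties using (lookup∘tabulate; tabulate∘lookup; tabulate-cong; lookup∘update; lookup∘update′)
open import Function using (_∘_; id)
open import Function.Bundles using (_⇔_; mk⇔)
open import Relation.Nullary using (¬_; Dec; yes; no; contradiction)
open import Relation.Nullary.Decidable using (map′; _×-dec_; _⊎-dec_)
open import Relation.Binary.PropositionalEquality
  using (_≡_; _≢_; _≗_; refl; sym; trans; cong; subst; module ≡-Reasoning)
open import Relation.Binary.Construct.Closure.ReflexiveTransitive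
  using (Star; ε; _◅_; _◅◅_) renaming (map to mapStar)

module Plays (G : Game) where
  open Game G

  prefix-suc : ∀ (f : ℕ → Pos) k → prefix G f (suc k) ≡ prefix G f k ++ [ f k ]
  prefix-suc f zero = refl
  prefix-suc f (suc k) = cong (f 0 ∷_) (prefix-suc (f ∘ suc) k)

  module PlayOf (σ : Strategy G A) (τ : Strategy G B) (p₀ : Pos) where

    strategyOf : Player → List Pos → Pos → Pos
    strategyOf A = proj₁ σ
    strategyOf B = proj₁ τ

    strategyOf-legal : ∀ pl h p → owner p ≡ pl → ∃ (p ⇒_) → p ⇒ strategyOf pl h p
    strategyOf-legal A = proj₂ σ
    strategyOf-legal B = proj₂ τ

    mutual
      play : ℕ → Pos
      play zero = p₀
      play (suc k) = strategyOf (owner (play k)) (history k) (play k)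

      history : ℕ → List Pos
      history zero = []
      history (suc k) = history k ++ [ play k ]

    prefix-play : ∀ k → prefix G play k ≡ history k
    prefix-play zero = refl
    prefix-play (suc k) = trans (prefix-suc play k) (cong (_++ [ play k ]) (prefix-play k))

    obeys : ∀ pl k → owner (play k) ≡ pl → play (suc k) ≡ strategyOf pl (prefix G play k) (play k)
    obeys pl k refl = cong (λ h → strategyOf (owner (play k)) h (play k)) (sym (prefix-play k))

    legal : ∀ k → ∃ (play k ⇒_) → play k ⇒ play (suc k)
    legal k ex = subst (play k ⇒_) (sym (obeys _ k refl))
                       (strategyOf-legal (owner (play k)) (prefix G play k) (play k) refl ex)

    module Winning {W : WinCond G} (succ? : ∀ p → Dec (∃ (p ⇒_)))
                   (B-moves : ∀ p → owner p ≡ B → ∃ (p ⇒_))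
                   (wins : ∀ π → Outcome G σ τ p₀ π → AWinsPlay G W π) where

      -- A stuck position would end a finite outcome, which A only wins at a B-position.
      moves-below : ∀ n k → k < n → play k ⇒ play (suc k)
      moves-below (suc n) k k<1+n with m<1+n⇒m<n∨m≡n k<1+n
      ... | inj₁ k<n = moves-below n k k<n
      ... | inj₂ refl with succ? (play k)
      ...   | yes ex = legal k ex
      ...   | no stuck = ⊥-elim (stuck (B-moves (play k) (wins finitePlay obeyed)))
        where
        finitePlay : Play G p₀
        finitePlay = finite k play refl (moves-below k) (λ p mv → stuck (p , mv))
        obeyed : ∀ j → j < k → Obeys G A σ play j × Obeys G B τ play j
        obeyed j _ = obeys A j , obeys B j

      moves : ∀ k → play k ⇒ play (suc k)
      moves k = moves-below (suc k) k ≤-refl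

      won : W play
      won = wins (infinite play refl moves) (λ k → obeys A k , obeys B k)

  module Preferring {pl : Player} (succ? : ∀ p → Dec (∃ (p ⇒_)))
    (Ok : List Pos → Pos → Set) (ok? : ∀ h p → Dec (Ok h p))
    (preferred : List Pos → Pos → Pos)
    (preferred-legal : ∀ {h p} → owner p ≡ pl → Ok h p → p ⇒ preferred h p) where

    choice : List Pos → Pos → Pos
    choice h p with ok? h p | succ? p
    ... | yes _ | _ = preferred h p
    ... | no _ | yes (p' , _) = p'
    ... | no _ | no _ = p

    choice-legal : ∀ h p → owner p ≡ pl → ∃ (p ⇒_) → p ⇒ choice h p
    choice-legal h p own ex with ok? h p | succ? p
    ... | yes ok | _ = preferred-legal own ok
    ... | no _ | yes (_ , mv) = mv
    ... | no _ | no stuck = contradiction ex stuck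

    strategy : Strategy G pl
    strategy = choice , choice-legal

    strategy-prefers : ∀ {h p} → Ok h p → choice h p ≡ preferred h p
    strategy-prefers {h} {p} ok with ok? h p
    ... | yes _ = refl
    ... | no ¬ok = contradiction ok ¬ok

record Run {X : Set} (R : X → X → Set) (x : X) : Set where
  field
    node  : ℕ → X
    start : node 0 ≡ x
    step  : ∀ k → R (node k) (node (suc k))

Achieves : {X : Set} → Objective → (X → Set) → (ℕ → X) → Set
Achieves reachability T f = ∃ λ k → T (f k)
Achieves safety T f = ∀ k → ¬ T (f k)

module _ {X : Set} {R : X → X → Set} where
  open Run

  _◅ʳ_ : ∀ {x y} → R x y → Run R y → Run R x
  _◅ʳ_ {x} e r = record { node = node' ; start = refl ; step = step' }
    where
    node' : ℕ → X
    node' zero = x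
    node' (suc k) = node r k
    step' : ∀ k → R (node' k) (node' (suc k))
    step' zero = subst (R x) (sym (start r)) e
    step' (suc k) = step r k

  prepend : ∀ {x y} → Star R x y → Run R y → Run R x
  prepend ε r = r
  prepend (e ◅ es) r = e ◅ʳ prepend es r

  prepend-eventually : ∀ {x y} {T : X → Set} (es : Star R x y) (r : Run R y) →
                       ∃ (T ∘ node r) → ∃ (T ∘ node (prepend es r))
  prepend-eventually ε r hit = hit
  prepend-eventually {T = T} (e ◅ es) r hit with prepend-eventually {T = T} es r hit
  ... | k , t = suc k , t

  unfold : {S : Set} (f : S → X) → (∀ u → Σ S λ u' → R (f u) (f u')) → (u₀ : S) → Run R (f u₀)
  unfold {S} f next u₀ = record { node = f ∘ iterate ; start = refl ; step = proj₂ ∘ next ∘ iterate }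
    where
    iterate : ℕ → S
    iterate zero = u₀
    iterate (suc k) = proj₁ (next (iterate k))

  cycle : ∀ {x y} → R x y → Star R y x → Run R x
  cycle {x} {y} e back = unfold proj₁ around (x , ε)
    where
    around : (u : Σ X λ z → Star R z x) → Σ (Σ X λ z → Star R z x) λ u' → R (proj₁ u) (proj₁ u')
    around (_ , ε) = (y , back) , e
    around (_ , e' ◅ es) = (_ , es) , e'

Run-map : ∀ {X Y : Set} {R : X → X → Set} {R' : Y → Y → Set} (f : X → Y) →
          (∀ {x y} → R x y → R' (f x) (f y)) → ∀ {x} → Run R x → Run R' (f x)
Run-map f g r = record { node = f ∘ node ; start = cong f start ; step = g ∘ step }
  where open Run r

Guarded : {X : Set} → (X → X → Set) → (X → Set) → X → X → Set
Guarded R Pd x y = R x y × Pd x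

unguard : ∀ {X : Set} {R : X → X → Set} {Pd x} → Run (Guarded R Pd) x → Run R x
unguard r = record { node = node ; start = start ; step = proj₁ ∘ step }
  where open Run r

sections-agree : ∀ {X : Set} {Y : X → Set} (f g : (x : X) → Y x) {x y} →
                 (x , f x) ≡ (y , g y) → g x ≡ f x
sections-agree {Y = Y} f g eq = agree eq refl refl
  where
  agree : ∀ {x y} {a : Y x} {b : Y y} → (x , a) ≡ (y , b) → f x ≡ a → g y ≡ b → g x ≡ f x
  agree refl refl gx≡fx = gx≡fx

repetition : ∀ {K : Set} (xs : List K) (f : ℕ → K) → (∀ k → f k ∈ xs) →
             ∃₂ λ i j → i < j × f i ≡ f j
repetition xs f all with pigeonhole ≤-refl (λ (i : Fin (suc (length xs))) → index (all (toℕ i)))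
... | i , j , i<j , same = toℕ i , toℕ j , i<j ,
  trans (lookup-index (all (toℕ i))) (trans (cong (List.lookup xs) same) (sym (lookup-index (all (toℕ j)))))

allVecs : {T : Set} → List T → (n : ℕ) → List (Vec T n)
allVecs xs zero = [ []ᵛ ]
allVecs xs (suc n) = cartesianProductWith _∷ᵛ_ xs (allVecs xs n)

∈-allVecs : ∀ {T : Set} {xs : List T} → (∀ x → x ∈ xs) → ∀ {n} (v : Vec T n) → v ∈ allVecs xs n
∈-allVecs all []ᵛ = here refl
∈-allVecs all (x ∷ᵛ v) = ∈-cartesianProductWith⁺ _∷ᵛ_ (all x) (∈-allVecs all v)

∈-bools : ∀ e → e ∈ true ∷ false ∷ []
∈-bools true = here refl
∈-bools false = there (here refl)

module _ {nX nV : ℕ} where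

  readValue : Buffer nX nV → (Fin nX → Fin nV) → Fin nX → Fin nV
  readValue w μ x = fromMaybe (μ x) (latest w x)

  readValue-cong : ∀ w {μ μ'} → μ' ≗ μ → readValue w μ' ≗ readValue w μ
  readValue-cong w μ'≗μ y with latest w y
  ... | just _ = refl
  ... | nothing = μ'≗μ y

  readValue-write : ∀ {w μ v} x d → readValue w μ ≗ lookup v →
                    readValue ((x , d) ∷ w) μ ≗ lookup (v [ x ]≔ d)
  readValue-write {v = v} x d reads y with x ≟ y
  ... | yes refl = sym (lookup∘update x v d)
  ... | no x≢y = trans (reads y) (sym (lookup∘update′ (x≢y ∘ sym) v d))

  readValue-flush : ∀ w {μ μ' x d} → μ' x ≡ d → (∀ y → y ≢ x → μ' y ≡ μ y) →
                    readValue (w ++ [ (x , d) ]) μ ≗ readValue w μ'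
  readValue-flush [] {x = x} μ'x≡d μ'≡μ y with x ≟ y
  ... | yes refl = sym μ'x≡d
  ... | no x≢y = sym (μ'≡μ y (x≢y ∘ sym))
  readValue-flush ((z , e) ∷ w) μ'x≡d μ'≡μ y with z ≟ y
  ... | yes _ = refl
  ... | no _ = readValue-flush w μ'x≡d μ'≡μ y

  snoc≢[] : ∀ (w : Buffer nX nV) msg → w ++ [ msg ] ≢ []
  snoc≢[] w msg eq with ++-conicalʳ w [ msg ] eq
  ... | ()

  null⇒[] : ∀ {w : Buffer nX nV} → null w ≡ true → w ≡ []
  null⇒[] {[]} _ = refl

  push : Buffer nX nV → Instr nX nV → Buffer nX nV
  push w (wr x d) = (x , d) ∷ w
  push w _ = w

  Enabled : (read : Fin nX → Fin nV) (empty : Bool) → Instr nX nV → Set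
  Enabled read empty (rd x d) = read x ≡ d
  Enabled read empty (wr x d) = ⊤
  Enabled read empty skip = ⊤
  Enabled read empty mf = empty ≡ true

  enabled? : ∀ read empty i → Dec (Enabled read empty i)
  enabled? read empty (rd x d) = read x ≟ d
  enabled? read empty (wr x d) = yes tt
  enabled? read empty skip = yes tt
  enabled? read empty mf = empty ≟ᵇ true

  enabled-mono : ∀ {read read' empty empty'} i → read ≗ read' → (empty ≡ true → empty' ≡ true) →
                 Enabled read empty i → Enabled read' empty' i
  enabled-mono (rd x d) read≗read' _ en = trans (sym (read≗read' x)) en
  enabled-mono (wr x d) _ _ _ = tt
  enabled-mono skip _ _ _ = tt
  enabled-mono mf _ empty⇒empty' en = empty⇒empty' en

  afterDrained : Bool → Instr nX nV → Bool
  afterDrained empty (wr x d) = false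
  afterDrained empty _ = empty

  afterValues : Vec (Fin nV) nX → Instr nX nV → Vec (Fin nV) nX
  afterValues v (wr x d) = v [ x ]≔ d
  afterValues v _ = v

  null-push : ∀ w i → null (push w i) ≡ afterDrained (null w) i
  null-push w (rd x d) = refl
  null-push w (wr x d) = refl
  null-push w skip = refl
  null-push w mf = refl

  empty-push : ∀ {w empty} i → (empty ≡ true → w ≡ []) → afterDrained empty i ≡ true → push w i ≡ []
  empty-push (rd x d) w≡[] = w≡[]
  empty-push (wr x d) w≡[] ()
  empty-push skip w≡[] = w≡[]
  empty-push mf w≡[] = w≡[]

  readValue-push : ∀ {w μ μ' v} i → μ' ≗ μ → readValue w μ ≗ lookup v →
                   readValue (push w i) μ' ≗ lookup (afterValues v i)
  readValue-push {w} {μ} {μ'} {v} i μ'≗μ reads = go i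
    where
    reads' : readValue w μ' ≗ lookup v
    reads' y = trans (readValue-cong w μ'≗μ y) (reads y)
    go : ∀ i → readValue (push w i) μ' ≗ lookup (afterValues v i)
    go (rd x d) = reads'
    go (wr x d) = readValue-write {v = v} x d reads'
    go skip = reads'
    go mf = reads'

∃-Instr? : ∀ {nX nV} {Q : Instr nX nV → Set} → (∀ i → Dec (Q i)) → Dec (∃ Q)
∃-Instr? {Q = Q} Q? = map′ from to
  (any? (λ x → any? (Q? ∘ rd x)) ⊎-dec any? (λ x → any? (Q? ∘ wr x)) ⊎-dec Q? skip ⊎-dec Q? mf)
  where
  Cases : Set
  Cases = (∃₂ λ x d → Q (rd x d)) ⊎ (∃₂ λ x d → Q (wr x d)) ⊎ Q skip ⊎ Q mf
  from : Cases → ∃ Q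
  from (inj₁ (x , d , q)) = rd x d , q
  from (inj₂ (inj₁ (x , d , q))) = wr x d , q
  from (inj₂ (inj₂ (inj₁ q))) = skip , q
  from (inj₂ (inj₂ (inj₂ q))) = mf , q
  to : ∃ Q → Cases
  to (rd x d , q) = inj₁ (x , d , q)
  to (wr x d , q) = inj₂ (inj₁ (x , d , q))
  to (skip , q) = inj₂ (inj₂ (inj₁ q))
  to (mf , q) = inj₂ (inj₂ (inj₂ q))

update : ∀ {n} {T : Fin n → Set} → ((j : Fin n) → T j) → (ι : Fin n) → T ι → (j : Fin n) → T j
update f ι t j with j ≟ ι
... | yes refl = t
... | no _ = f j

update-same : ∀ {n} {T : Fin n → Set} (f : (j : Fin n) → T j) ι t → update f ι t ι ≡ t
update-same f ι t with ι ≟ ι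
... | yes refl = refl
... | no ι≢ι = contradiction refl ι≢ι

update-other : ∀ {n} {T : Fin n → Set} (f : (j : Fin n) → T j) ι t {j} → j ≢ ι → update f ι t j ≡ f j
update-other f ι t {j} j≢ι with j ≟ ι
... | yes j≡ι = contradiction j≡ι j≢ι
... | no _ = refl

module _ {nX nV nI : ℕ} {P : Program nX nV nI} where

  EnabledAt : Config P → Fin nI → Instr nX nV → Set
  EnabledAt c ι = Enabled (readValue (b c ι) (m c)) (null (b c ι))

  effect-buffer : ∀ {c c' : Config P} {ι i} → Effect c c' ι i → b c' ι ≡ push (b c ι) i
  effect-buffer (rd-own _ _ _ eq _) = eq
  effect-buffer (rd-mem _ _ _ _ eq _) = eq
  effect-buffer (write _ _ eq _) = eq
  effect-buffer (skp eq _) = eq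
  effect-buffer (fence _ eq _) = eq

  effect-memory : ∀ {c c' : Config P} {ι i} → Effect c c' ι i → m c' ≗ m c
  effect-memory (rd-own _ _ _ _ eq) = eq
  effect-memory (rd-mem _ _ _ _ _ eq) = eq
  effect-memory (write _ _ _ eq) = eq
  effect-memory (skp _ eq) = eq
  effect-memory (fence _ _ eq) = eq

  effect-enabled : ∀ {c c' : Config P} {ι i} → Effect c c' ι i → EnabledAt c ι i
  effect-enabled {c} (rd-own x d own _ _) = cong (fromMaybe (m c x)) own
  effect-enabled {c} (rd-mem x d none md _ _) = trans (cong (fromMaybe (m c x)) none) md
  effect-enabled (write _ _ _ _) = tt
  effect-enabled (skp _ _) = tt
  effect-enabled (fence empty _ _) = cong null empty

  next : Config P → (ι : Fin nI) → Instr nX nV → Fin (nQ (P ι)) → Config P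
  next c ι i q = ⟨ update (s c) ι q , update (b c) ι (push (b c ι) i) , m c ⟩

  next-effect : ∀ c ι i q → EnabledAt c ι i → Effect c (next c ι i q) ι i
  next-effect c ι (rd x d) q en with latest (b c ι) x in own
  ... | just _ = rd-own x d (trans own (cong just en)) (update-same (b c) ι _) (λ _ → refl)
  ... | nothing = rd-mem x d own en (update-same (b c) ι _) (λ _ → refl)
  next-effect c ι (wr x d) q _ = write x d (update-same (b c) ι _) (λ _ → refl)
  next-effect c ι skip q _ = skp (update-same (b c) ι _) (λ _ → refl)
  next-effect c ι mf q empty = fence (null⇒[] empty) (update-same (b c) ι _) (λ _ → refl)

  next-step : ∀ {c ι i q} → δ (P ι) (s c ι) i q ≡ true → EnabledAt c ι i → InstrStepBy ι c (next c ι i q)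
  next-step {c} {ι} {i} {q} local en = record
    { instr = i
    ; local = subst (λ q' → δ (P ι) (s c ι) i q' ≡ true) (sym (update-same (s c) ι q)) local
    ; effect = next-effect c ι i q en
    ; othersS = λ j → update-other (s c) ι q
    ; othersB = λ j → update-other (b c) ι _ }

  instrStep? : (c : Config P) → Dec (∃ (InstrStep c))
  instrStep? c = map′ from to
    (any? λ ι → ∃-Instr? λ i → any? λ q → (δ (P ι) (s c ι) i q ≟ᵇ true) ×-dec enabled? _ _ i)
    where
    open InstrStepBy
    Enabling : Set
    Enabling = ∃ λ ι → ∃ λ i → ∃ λ q → δ (P ι) (s c ι) i q ≡ true × EnabledAt c ι i
    from : Enabling → ∃ (InstrStep c)
    from (ι , i , q , local , en) = next c ι i q , ι , next-step local en
    to : ∃ (InstrStep c) → Enabling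
    to (c' , ι , st) = ι , instr st , s c' ι , local st , effect-enabled (effect st)

  move? : (p : Config P × Player) → Dec (∃ (Move P p))
  move? (c , A) = map′ (λ { (c' , st) → (c' , B) , proc st }) (λ { (_ , proc st) → _ , st }) (instrStep? c)
  move? (c , B) = yes ((c , A) , upd ε)

  B-moves : ∀ p → proj₂ p ≡ B → ∃ (Move P p)
  B-moves (c , B) refl = (c , A) , upd ε

  move-by-A : ∀ {p p'} → Move P p p' → proj₂ p ≡ A → InstrStep (proj₁ p) (proj₁ p') × proj₂ p' ≡ B
  move-by-A (proc st) refl = st , refl

  move-by-B : ∀ {p p'} → Move P p p' → proj₂ p ≡ B → Updates (proj₁ p) (proj₁ p') × proj₂ p' ≡ A
  move-by-B (upd ups) refl = ups , refl

idle : ∀ {nX nV nI} (P : Program nX nV nI) → Strategy (TSOGame P) B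
idle P = (λ _ p → proj₁ p , A) , λ { _ (c , B) refl _ → upd ε }

-- Views

record View {nX nV : ℕ} (Pr : Process nX nV) : Set where
  constructor ⟪_,_,_⟫
  field
    state   : Fin (nQ Pr)
    drained : Bool
    values  : Vec (Fin nV) nX

open View public

record ViewStep {nX nV : ℕ} (Pr : Process nX nV) (a a' : View Pr) : Set where
  field
    instr    : Instr nX nV
    local    : δ Pr (state a) instr (state a') ≡ true
    enabled  : Enabled (lookup (values a)) (drained a) instr
    drained' : drained a' ≡ afterDrained (drained a) instr
    values'  : values a' ≡ afterValues (values a) instr

allViews : ∀ {nX nV} (Pr : Process nX nV) → List (View Pr)
allViews {nX} {nV} Pr = cartesianProductWith (λ q ev → ⟪ q , proj₁ ev , proj₂ ev ⟫) (allFin (nQ Pr))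
                          (cartesianProduct (true ∷ false ∷ []) (allVecs (allFin nV) nX))

∈-allViews : ∀ {nX nV} {Pr : Process nX nV} (a : View Pr) → a ∈ allViews Pr
∈-allViews ⟪ q , e , v ⟫ =
  ∈-cartesianProductWith⁺ _ (∈-allFin q) (∈-cartesianProduct⁺ (∈-bools e) (∈-allVecs ∈-allFin v))

tabulate-≗ : ∀ {n} {T : Set} {f : Fin n → T} {v} → f ≗ lookup v → tabulate f ≡ v
tabulate-≗ {v = v} f≗v = trans (tabulate-cong f≗v) (tabulate∘lookup v)

module _ {nX nV nI : ℕ} {P : Program nX nV nI} where

  view : Config P → (ι : Fin nI) → View (P ι)
  view c ι = ⟪ s c ι , null (b c ι) , tabulate (readValue (b c ι) (m c)) ⟫

  reads-view : ∀ (c : Config P) ι → readValue (b c ι) (m c) ≗ lookup (values (view c ι))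
  reads-view c ι x = sym (lookup∘tabulate _ x)

  view-step : ∀ {ι c c'} → InstrStepBy ι c c' → ViewStep (P ι) (view c ι) (view c' ι)
  view-step {ι} {c} {c'} st = record
    { instr = instr
    ; local = local
    ; enabled = enabled-mono instr (reads-view c ι) id (effect-enabled effect)
    ; drained' = trans (cong null (effect-buffer effect)) (null-push (b c ι) instr)
    ; values' = tabulate-≗ λ x →
        trans (cong (λ w → readValue w (m c') x) (effect-buffer effect))
              (readValue-push instr (effect-memory effect) (reads-view c ι) x) }
    where open InstrStepBy st

  view-frozen : ∀ {ι c c'} → InstrStepBy ι c c' → ∀ {j} → j ≢ ι → view c' j ≡ view c j
  view-frozen {c = c} st {j} j≢ι rewrite InstrStepBy.othersS st j j≢ι | InstrStepBy.othersB st j j≢ι =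
    cong ⟪ s c j , null (b c j) ,_⟫
         (tabulate-cong (readValue-cong (b c j) (effect-memory (InstrStepBy.effect st))))

Target : ∀ {nX nV nI} {P : Program nX nV nI} → LocalStates P → (ι : Fin nI) → View (P ι) → Set
Target F ι a = F ι (state a) ≡ true

IsolatedRun : ∀ {nX nV nI} (P : Program nX nV nI) → LocalStates P → Objective → Config P → Fin nI → Set
IsolatedRun P F o c ι =
  Σ (Run (ViewStep (P ι)) (view {P = P} c ι)) λ r → Achieves o (Target {P = P} F ι) (Run.node r)

⌊k*2/2⌋≡k : ∀ k → ⌊ k * 2 /2⌋ ≡ k
⌊k*2/2⌋≡k zero = refl
⌊k*2/2⌋≡k (suc k) = cong suc (⌊k*2/2⌋≡k k)

even⊎odd : ∀ n → ∃ λ k → n ≡ k * 2 ⊎ n ≡ suc (k * 2)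
even⊎odd zero = 0 , inj₁ refl
even⊎odd (suc n) with even⊎odd n
... | k , inj₁ refl = k , inj₂ refl
... | k , inj₂ refl = suc k , inj₁ refl

-- Replaying an isolated run

module Replay {nX nV nI : ℕ} (P : Program nX nV nI) (F : LocalStates P) (c₀ : Config P)
  (empty₀ : ∀ j → b c₀ j ≡ []) (notF : ∀ j → F j (s c₀ j) ≡ false)
  (ι : Fin nI) (r : Run (ViewStep (P ι)) (view c₀ ι)) where

  open Run r
  open Plays (TSOGame P)

  -- Updates may empty ι's buffer behind the view's back, hence only an implication for drained.
  record Synced (a : View (P ι)) (c : Config P) : Set where
    field
      state≡      : s c ι ≡ state a
      drained⇒[]  : drained a ≡ true → b c ι ≡ []
      reads       : readValue (b c ι) (m c) ≗ lookup (values a)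
      others-idle : ∀ j → j ≢ ι → b c j ≡ [] × s c j ≡ s c₀ j

  synced-start : Synced (node 0) c₀
  synced-start rewrite start = record
    { state≡ = refl ; drained⇒[] = λ _ → empty₀ ι ; reads = reads-view c₀ ι
    ; others-idle = λ j _ → empty₀ j , refl }

  instrAt : ℕ → Instr nX nV
  instrAt k = ViewStep.instr (step k)

  Advance : Config P → ℕ → Set
  Advance c k = δ (P ι) (s c ι) (instrAt k) (state (node (suc k))) ≡ true × EnabledAt c ι (instrAt k)

  advance? : ∀ c k → Dec (Advance c k)
  advance? c k = (_ ≟ᵇ true) ×-dec enabled? _ _ (instrAt k)

  advance : Config P → ℕ → Config P
  advance c k = next c ι (instrAt k) (state (node (suc k)))

  synced-advance : ∀ {c k} → Synced (node k) c → Advance c k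
  synced-advance {c} {k} sy =
    subst (λ q → δ (P ι) q (instrAt k) _ ≡ true) (sym state≡) local ,
    enabled-mono (instrAt k) (sym ∘ reads) (cong null ∘ drained⇒[]) enabled
    where
    open Synced sy
    open ViewStep (step k)

  synced-next : ∀ {c k} → Synced (node k) c → Synced (node (suc k)) (advance c k)
  synced-next {c} {k} sy = record
    { state≡ = update-same (s c) ι _
    ; drained⇒[] = λ e → trans (update-same (b c) ι _) (empty-push instr drained⇒[] (trans (sym drained') e))
    ; reads = λ x → trans (cong (λ w → readValue w (m c) x) (update-same (b c) ι _))
                    (trans (readValue-push instr (λ _ → refl) reads x) (cong (λ v → lookup v x) (sym values')))
    ; others-idle = λ j j≢ι → trans (update-other (b c) ι _ j≢ι) (proj₁ (others-idle j j≢ι)) ,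
                              trans (update-other (s c) ι _ j≢ι) (proj₂ (others-idle j j≢ι)) }
    where
    open Synced sy
    open ViewStep (step k)

  synced-update : ∀ {a c c'} → Synced a c → UpdateStep c c' → Synced a c'
  synced-update {a} {c} {c'} sy u with UpdateStep.ι u ≟ ι
  ... | no j≢ι = contradiction (trans (sym buf) (proj₁ (others-idle _ j≢ι))) (snoc≢[] w _)
    where
    open Synced sy
    open UpdateStep u
  ... | yes refl = record
    { state≡ = trans (sameS ι) state≡
    ; drained⇒[] = λ e → contradiction (trans (sym buf) (drained⇒[] e)) (snoc≢[] w _)
    ; reads = λ y → begin
        readValue (b c' ι) (m c') y           ≡⟨ cong (λ w' → readValue w' (m c') y) buf' ⟩
        readValue w (m c') y                  ≡⟨ sym (readValue-flush w memx memy y) ⟩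
        readValue (w ++ [ (x , d) ]) (m c) y  ≡⟨ cong (λ w' → readValue w' (m c) y) (sym buf) ⟩
        readValue (b c ι) (m c) y             ≡⟨ reads y ⟩
        lookup (values a) y                   ∎
    ; others-idle = λ j j≢ι → trans (othersB j j≢ι) (proj₁ (others-idle j j≢ι)) ,
                              trans (sameS j) (proj₂ (others-idle j j≢ι)) }
    where
    open ≡-Reasoning
    open Synced sy
    open UpdateStep u hiding (ι)

  synced-updates : ∀ {a c c'} → Synced a c → Updates c c' → Synced a c'
  synced-updates sy ε = sy
  synced-updates sy (u ◅ us) = synced-updates (synced-update sy u) us

  advance-move : ∀ {p} k → proj₂ p ≡ A → Advance (proj₁ p) k → Move P p (advance (proj₁ p) k , B)
  advance-move {c , A} k refl (local , en) = proc (ι , next-step local en)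

  -- Positions alternate between the two players, so this is the number of moves ι has made.
  movesMade : List (Config P × Player) → ℕ
  movesMade h = ⌊ length h /2⌋

  open Preferring move? (λ h p → Advance (proj₁ p) (movesMade h)) (λ h p → advance? (proj₁ p) (movesMade h))
                  (λ h p → advance (proj₁ p) (movesMade h) , B) (λ {h} → advance-move (movesMade h))

  movesMade-prefix : ∀ f k → movesMade (prefix (TSOGame P) f (k * 2)) ≡ k
  movesMade-prefix f k = trans (cong ⌊_/2⌋ (length-tabulate {n = k * 2} _)) (⌊k*2/2⌋≡k k)

  module _ (f : ℕ → Config P × Player) (f₀ : f 0 ≡ (c₀ , A)) where

    Consistent : ℕ → Set
    Consistent n = ∀ k → k < n → Move P (f k) (f (suc k)) × Obeys (TSOGame P) A strategy f k

    shorten : ∀ {n} → Consistent (suc n) → Consistent n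
    shorten cons k k<n = cons k (m<n⇒m<1+n k<n)

    mutual
      synced-even : ∀ k → Consistent (k * 2) → proj₂ (f (k * 2)) ≡ A × Synced (node k) (proj₁ (f (k * 2)))
      synced-even zero _ rewrite f₀ = refl , synced-start
      synced-even (suc k) cons = proj₂ updates , synced-updates (proj₂ odd) (proj₁ updates)
        where
        odd : proj₂ (f (suc (k * 2))) ≡ B × Synced (node (suc k)) (proj₁ (f (suc (k * 2))))
        odd = synced-odd k (shorten cons)
        updates : Updates (proj₁ (f (suc (k * 2)))) (proj₁ (f (suc (suc (k * 2))))) × proj₂ (f (suc (suc (k * 2)))) ≡ A
        updates = move-by-B (proj₁ (cons (suc (k * 2)) (n<1+n _))) (proj₁ odd)

      synced-odd : ∀ k → Consistent (suc (k * 2)) →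
                   proj₂ (f (suc (k * 2))) ≡ B × Synced (node (suc k)) (proj₁ (f (suc (k * 2))))
      synced-odd k cons =
        cong proj₂ moved , subst (Synced (node (suc k))) (sym (cong proj₁ moved)) (synced-next (proj₂ even))
        where
        open ≡-Reasoning
        c : Config P
        c = proj₁ (f (k * 2))
        h : List (Config P × Player)
        h = prefix (TSOGame P) f (k * 2)
        even : proj₂ (f (k * 2)) ≡ A × Synced (node k) c
        even = synced-even k (shorten cons)
        moved : f (suc (k * 2)) ≡ (advance c k , B)
        moved = begin
          f (suc (k * 2))                 ≡⟨ proj₂ (cons (k * 2) (n<1+n _)) (proj₁ even) ⟩
          choice h (f (k * 2))            ≡⟨ strategy-prefers (subst (Advance c) (sym (movesMade-prefix f k))
                                                                      (synced-advance (proj₂ even))) ⟩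
          (advance c (movesMade h) , B)   ≡⟨ cong (λ n → advance c n , B) (movesMade-prefix f k) ⟩
          (advance c k , B)               ∎

    synced-somewhere : ∀ n → Consistent n → ∃ λ k → Synced (node k) (proj₁ (f n))
    synced-somewhere n cons with even⊎odd n
    ... | k , inj₁ refl = k , proj₂ (synced-even k cons)
    ... | k , inj₂ refl = suc k , proj₂ (synced-odd k cons)

    can-move : ∀ n → Consistent n → ∃ (Move P (f n))
    can-move n cons with even⊎odd n
    ... | k , inj₁ refl = _ , advance-move k (proj₁ (synced-even k cons)) (synced-advance (proj₂ (synced-even k cons)))
    ... | k , inj₂ refl = B-moves (f (suc (k * 2))) (proj₁ (synced-odd k cons))

    achieved : ∀ o → Achieves o (Target {P = P} F ι) node → (∀ n → Consistent n) → winCond P o F f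
    achieved reachability (k , hit) cons =
      k * 2 , ι , trans (cong (F ι) (Synced.state≡ (proj₂ (synced-even k (cons (k * 2)))))) hit
    achieved safety safe cons n (j , hit) with synced-somewhere n (cons n)
    ... | k , sy with j ≟ ι
    ...   | yes refl = safe k (trans (cong (F ι) (sym (Synced.state≡ sy))) hit)
    ...   | no j≢ι = contradiction
                       (trans (sym hit) (trans (cong (F j) (proj₂ (Synced.others-idle sy j j≢ι))) (notF j))) λ ()

  replay-wins : ∀ {o} → Achieves o (Target {P = P} F ι) node → ProcessWins P o F c₀
  replay-wins {o} ok = strategy , wins
    where
    wins : ∀ τ π → Outcome (TSOGame P) strategy τ (c₀ , A) π → AWinsPlay (TSOGame P) (winCond P o F) π
    wins _ (finite n f f₀ moves stuck) obeys =
      ⊥-elim (stuck _ (proj₂ (can-move f f₀ n λ k k<n → moves k k<n , proj₁ (obeys k k<n))))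
    wins _ (infinite f f₀ moves) obeys = achieved f f₀ o ok λ n k _ → moves k , proj₁ (obeys k)

isolated⇒wins : ∀ {nX nV nI} {P : Program nX nV nI} {F : LocalStates P} {o c₀} →
                (∀ j → b c₀ j ≡ []) → (∀ j → F j (s c₀ j) ≡ false) →
                ∀ ι → IsolatedRun P F o c₀ ι → ProcessWins P o F c₀
isolated⇒wins {P = P} {F} {c₀ = c₀} empty₀ notF ι (r , ok) = Replay.replay-wins P F c₀ empty₀ notF ι r ok

-- Extracting an isolated run from a winning strategy

module _ {nX nV nI : ℕ} (P : Program nX nV nI) (F : LocalStates P) where

  -- Against the idle update player, even positions are followed by an instruction step and
  -- odd ones by the empty update sequence.
  idle-run : ∀ {o c₀} → ProcessWins P o F c₀ → Σ (Run InstrStep c₀) λ r → Achieves o (InF F) (Run.node r)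
  idle-run {o} {c₀} (σ , wins) = record { node = after ; start = refl ; step = step } , achieved o won
    where
    open Plays.PlayOf (TSOGame P) σ (idle P) (c₀ , A)
    open Winning move? B-moves (wins (idle P))

    after : ℕ → Config P
    after k = proj₁ (play (k * 2))

    mutual
      owner-even : ∀ k → proj₂ (play (k * 2)) ≡ A
      owner-even zero = refl
      owner-even (suc k) = cong proj₂ (idle-skips k)

      round-move : ∀ k → InstrStep (after k) (proj₁ (play (suc (k * 2)))) × proj₂ (play (suc (k * 2))) ≡ B
      round-move k = move-by-A (moves (k * 2)) (owner-even k)

      idle-skips : ∀ k → play (suc (suc (k * 2))) ≡ (proj₁ (play (suc (k * 2))) , A)
      idle-skips k = obeys B (suc (k * 2)) (proj₂ (round-move k))

    step : ∀ k → InstrStep (after k) (after (suc k))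
    step k = subst (InstrStep (after k)) (sym (cong proj₁ (idle-skips k))) (proj₁ (round-move k))

    achieved : ∀ o → winCond P o F play → Achieves o (InF F) after
    achieved reachability (n , hit) with even⊎odd n
    ... | k , inj₁ refl = k , hit
    ... | k , inj₂ refl = suc k , subst (InF F) (sym (cong proj₁ (idle-skips k))) hit
    achieved safety safe k = safe (k * 2)

  run-on : NoDeadlockFromTarget P F → ∀ {ι q} → F ι q ≡ true →
           (c : Config P) → Star (LEdge (P ι)) q (s c ι) → Run (ViewStep (P ι)) (view c ι)
  run-on nd {ι} {q} hit c path = unfold (λ u → view (proj₁ u) ι) onward (c , path)
    where
    Reached : Set
    Reached = Σ (Config P) λ c → Star (LEdge (P ι)) q (s c ι)
    onward : (u : Reached) → Σ Reached λ u' → ViewStep (P ι) (view (proj₁ u) ι) (view (proj₁ u') ι)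
    onward (c , path) with nd ι q (s c ι) hit path c refl
    ... | c' , st = (c' , path ◅◅ ((InstrStepBy.instr st , InstrStepBy.local st) ◅ ε)) , view-step st

  module Isolate {c₀ : Config P} (r : Run InstrStep c₀) where
    open Run r

    mover : ℕ → Fin nI
    mover k = proj₁ (step k)

    views-path : ∀ {ι} (Pd : View (P ι) → Set) → (∀ k → Pd (view (node k) ι)) →
                 ∀ {i j} → i ≤′ j → Star (Guarded (ViewStep (P ι)) Pd) (view (node i) ι) (view (node j) ι)
    views-path Pd pd ≤′-refl = ε
    views-path {ι} Pd pd (≤′-step {j} i≤′j) with mover j ≟ ι
    ... | yes refl = views-path Pd pd i≤′j ◅◅ ((view-step (proj₂ (step j)) , pd j) ◅ ε)
    ... | no j≢ι = subst (Star _ _) (sym (view-frozen (proj₂ (step j)) (j≢ι ∘ sym))) (views-path Pd pd i≤′j)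

    views-from-start : ∀ {ι} (Pd : View (P ι) → Set) → (∀ k → Pd (view (node k) ι)) →
                       ∀ k → Star (Guarded (ViewStep (P ι)) Pd) (view c₀ ι) (view (node k) ι)
    views-from-start {ι} Pd pd k = subst (λ c → Star _ (view c ι) _) start (views-path Pd pd z≤′n)

    reach-isolated : NoDeadlockFromTarget P F → ∀ k ι → F ι (s (node k) ι) ≡ true →
                     IsolatedRun P F reachability c₀ ι
    reach-isolated nd k ι hit =
      prepend before continued , prepend-eventually {T = Target {P = P} F ι} before continued (0 , hit)
      where
      before : Star (ViewStep (P ι)) (view c₀ ι) (view (node k) ι)
      before = mapStar proj₁ (views-from-start (λ _ → ⊤) (λ _ → tt) k)
      continued : Run (ViewStep (P ι)) (view (node k) ι)
      continued = run-on nd hit (node k) ε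

    allKeys : List (Σ (Fin nI) (View ∘ P))
    allKeys = concatMap (λ j → List.map (j ,_) (allViews (P j))) (allFin nI)

    ∈-allKeys : ∀ key → key ∈ allKeys
    ∈-allKeys (j , a) = ∈-concatMap⁺ _ (lose (∈-allFin j) (∈-map⁺ (j ,_) (∈-allViews a)))

    key : ℕ → Σ (Fin nI) (View ∘ P)
    key k = mover k , view (node k) (mover k)

    -- Guarding each step with ¬ Target records that every node of the lasso avoids F.
    lasso : (∀ k → ¬ InF F (node k)) → ∀ i j → i < j → key i ≡ key j → ∃ (IsolatedRun P F safety c₀)
    lasso safe i j i<j same = ι , unguard run , proj₂ ∘ Run.step run
      where
      ι : Fin nI
      ι = mover i
      Pd : View (P ι) → Set
      Pd a = ¬ Target {P = P} F ι a
      pd : ∀ k → Pd (view (node k) ι)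
      pd k hit = safe k (ι , hit)
      back : Star (Guarded (ViewStep (P ι)) Pd) (view (node (suc i)) ι) (view (node i) ι)
      back = subst (Star _ _) (sections-agree (view (node i)) (view (node j)) same) (views-path Pd pd (≤⇒≤′ i<j))
      run : Run (Guarded (ViewStep (P ι)) Pd) (view c₀ ι)
      run = prepend (views-from-start Pd pd i) (cycle (view-step (proj₂ (step i)) , pd i) back)

    safe-isolated : (∀ k → ¬ InF F (node k)) → ∃ (IsolatedRun P F safety c₀)
    safe-isolated safe =
      let i , j , i<j , same = repetition allKeys key (∈-allKeys ∘ key) in lasso safe i j i<j same

    isolate : ∀ {o} → (o ≡ reachability → NoDeadlockFromTarget P F) → Achieves o (InF F) node →
              ∃ (IsolatedRun P F o c₀)
    isolate {reachability} nd (k , ι , hit) = ι , reach-isolated (nd refl) k ι hit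
    isolate {safety} _ safe = safe-isolated safe

  wins⇒isolated : ∀ {o c₀} → (o ≡ reachability → NoDeadlockFromTarget P F) →
                  ProcessWins P o F c₀ → ∃ (IsolatedRun P F o c₀)
  wins⇒isolated nd won = Isolate.isolate (proj₁ (idle-run won)) nd (proj₂ (idle-run won))

single-wins⇒isolated : ∀ {nX nV nI} {P : Program nX nV nI} {F : LocalStates P} {o c₀} ι →
                       ProcessWins (single P ι) o (restrict P F ι) (project c₀ ι) → IsolatedRun P F o c₀ ι
single-wins⇒isolated {P = P} {F} {o} {c₀} ι won = Run-map (λ c → view c zero) only r , achieved o (proj₂ solo)
  where
  solo : Σ (Run InstrStep (project c₀ ι)) λ r → Achieves o (InF (restrict P F ι)) (Run.node r)
  solo = idle-run (single P ι) (restrict P F ι) won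
  r : Run InstrStep (project c₀ ι)
  r = proj₁ solo
  only : ∀ {c c'} → InstrStep {P = single P ι} c c' → ViewStep (P ι) (view c zero) (view c' zero)
  only (zero , st) = view-step st
  achieved : ∀ o → Achieves o (InF (restrict P F ι)) (Run.node r) →
             Achieves o (Target {P = P} F ι) (λ k → view (Run.node r k) zero)
  achieved reachability (k , zero , hit) = k , hit
  achieved safety safe k hit = safe k (zero , hit)

theorem1 : ∀ {nX nV nI : ℕ} (P : Program nX nV nI) (F : LocalStates P)
             (o : Objective) →
             (o ≡ reachability → NoDeadlockFromTarget P F) →
             (c₀ : Config P) →
             (∀ ι → b c₀ ι ≡ []) →
             (∀ ι → F ι (s c₀ ι) ≡ false) →
             ProcessWins P o F c₀ ⇔
               Σ (Fin nI) (λ ι → ProcessWins (single P ι) o (restrict P F ι) (project c₀ ι))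
theorem1 {nI = nI} P F o nd c₀ empty₀ notF = mk⇔ forward backward
  where
  Solo : Fin nI → Set
  Solo ι = ProcessWins (single P ι) o (restrict P F ι) (project c₀ ι)
  -- An isolated run of ι in P is, verbatim, an isolated run of the only process of ⟨P^ι⟩.
  forward : ProcessWins P o F c₀ → Σ (Fin nI) Solo
  forward won with ι , run ← wins⇒isolated P F nd won =
    ι , isolated⇒wins (λ _ → empty₀ ι) (λ _ → notF ι) zero run
  backward : Σ (Fin nI) Solo → ProcessWins P o F c₀
  backward (ι , won) = isolated⇒wins empty₀ notF ι (single-wins⇒isolated {P = P} {F} {c₀ = c₀} ι won)
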